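{- Let $t\ge1$ and $b>a\ge1$ be integers. The rooted graph $T_{S_t}(a,b)$ is balanced and has rooted density $b/a$.
   Context: A rooted graph $(F,R)$ is a graph $F$ with a specified set $R\subseteq V(F)$ of root vertices. For nonempty $S\subseteq V(F)\setminus R$, the rooted density is $d(S)=e(S)/|S|$, where $e(S)$ is the number of edges of $F$ with at least one endpoint in $S$; the rooted density of $(F,R)$ is $d(V(F)\setminus R)$. $(F,R)$ is balanced if $d(S)\ge d(V(F)\setminus R)$ for every nonempty $S\subseteq V(F)\setminus R$. The Bukh–Conlon tree $T_2(a,b)$ (for integers $b>a\ge1$) is the rooted tree obtained from a path $u_1,\dots,u_a$ of non-root vertices (the spine) by attaching a new leaf, which is a root, to $u_i$ once for each time $i$ appears in the sequence $\lfloor 1+0\cdot\frac{a}{b-a}\rfloor,\lfloor 1+1\cdot\frac{a}{b-a}\rfloor,\dots,\lfloor 1+(b-a-1)\cdot\frac{a}{b-a}\rfloor, a$. $T_{S_t}(a,b)$ is obtained from $T_2(a,b)$ by attaching $t-1$ new leaves, all of which are roots, to each root vertex of $T_2(a,b)$ that is adjacent to some $u_i$ with $i$ odd; the spine vertices remain the only non-root vertices. -}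

module Defs where

open import Data.Bool using (Bool; true; false; if_then_else_; _∨_; _∧_; not)
open import Data.Nat using (ℕ; zero; suc; _+_; _*_; _∸_; _≤_; _<_; _<ᵇ_; _≤ᵇ_; _≡ᵇ_; _%_; _/_)
open import Data.List using (List; []; _∷_; _++_; map; upTo)
open import Data.Product using (_×_; _,_; Σ; ∃)
open import Relation.Binary.PropositionalEquality using (_≡_)

-- Finite rooted graphs.
-- Vertices are the natural numbers 0, …, nV-1; an edge {u,v} is listed
-- once as a pair (u , v); isRoot is the characteristic function of R.

record RootedGraph : Set where
  field
    nV     : ℕ
    edges  : List (ℕ × ℕ)
    isRoot : ℕ → Bool
open RootedGraph public

VSet : Set
VSet = ℕ → Bool

nonRoots : RootedGraph → VSet
nonRoots G v = (v <ᵇ nV G) ∧ not (isRoot G v)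

IsNonRootSubset : RootedGraph → VSet → Set
IsNonRootSubset G S = ∀ v → S v ≡ true → nonRoots G v ≡ true

Nonempty : VSet → Set
Nonempty S = ∃ λ v → S v ≡ true

countBelow : VSet → ℕ → ℕ
countBelow S zero = 0
countBelow S (suc n) = (if S n then 1 else 0) + countBelow S n

card : RootedGraph → VSet → ℕ
card G S = countBelow S (nV G)

countEdges : VSet → List (ℕ × ℕ) → ℕ
countEdges S [] = 0
countEdges S ((u , v) ∷ es) = (if S u ∨ S v then 1 else 0) + countEdges S es

eS : RootedGraph → VSet → ℕ
eS G S = countEdges S (edges G)

-- rooted density d(S) = e(S)/|S|; comparisons and equalities of these
-- fractions (with positive denominators) are expressed by cross-multiplication.

Balanced : RootedGraph → Set
Balanced G = ∀ (S : VSet) → IsNonRootSubset G S → Nonempty S →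
  eS G (nonRoots G) * card G S ≤ eS G S * card G (nonRoots G)

HasRootedDensity : RootedGraph → ℕ → ℕ → Set
HasRootedDensity G p q =
  (0 < card G (nonRoots G)) × (eS G (nonRoots G) * q ≡ p * card G (nonRoots G))

-- Labelling: spine vertex u_i (1 ≤ i ≤ a) is vertex i-1;
-- the roots of T₂(a,b) are r_j = vertex a + j for 0 ≤ j ≤ b-a, where r_j
-- is the leaf attached for the j-th entry s_j of the sequence
--   s_j = ⌊1 + j·a/(b-a)⌋ (0 ≤ j < b-a),  s_{b-a} = a.
-- The extra leaves of T_{S_t}(a,b) get consecutive labels from a+(b-a+1) on.

-- ⌊m / d⌋, with the (unused) convention ⌊m/0⌋ = 0
floorDiv : ℕ → ℕ → ℕ
floorDiv m zero = 0
floorDiv m (suc d) = m / suc d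

seqBC : ℕ → ℕ → ℕ → ℕ
seqBC a b j = if j <ᵇ (b ∸ a) then 1 + floorDiv (j * a) (b ∸ a) else a

isOdd : ℕ → Bool
isOdd n = n % 2 ≡ᵇ 1

spineEdges : ℕ → List (ℕ × ℕ)
spineEdges a = map (λ i → (i , suc i)) (upTo (a ∸ 1))

rootEdges : ℕ → ℕ → List (ℕ × ℕ)
rootEdges a b = map (λ j → (seqBC a b j ∸ 1 , a + j)) (upTo (suc (b ∸ a)))

newLeaves : ℕ → ℕ → ℕ → List (ℕ × ℕ)
newLeaves r next zero = []
newLeaves r next (suc k) = (r , next) ∷ newLeaves r (suc next) k

extraLeaves : ℕ → ℕ → ℕ → List ℕ → ℕ → List (ℕ × ℕ) × ℕ
extraLeaves a b t [] next = [] , next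
extraLeaves a b t (j ∷ js) next with isOdd (seqBC a b j)
... | true  = let (es , nx) = extraLeaves a b t js (next + (t ∸ 1))
              in newLeaves (a + j) next (t ∸ 1) ++ es , nx
... | false = extraLeaves a b t js next

extraT : ℕ → ℕ → ℕ → List (ℕ × ℕ) × ℕ
extraT a b t = extraLeaves a b t (upTo (suc (b ∸ a))) (a + suc (b ∸ a))

TSt : ℕ → ℕ → ℕ → RootedGraph
TSt t a b = record
  { nV     = Data.Product.proj₂ (extraT a b t)
  ; edges  = spineEdges a ++ rootEdges a b ++ Data.Product.proj₁ (extraT a b t)
  ; isRoot = λ v → a ≤ᵇ v
  }

module Submission where

open import Defs
open import Data.Nat using (ℕ; _≤_; _<_)
open import Data.Product using (_×_)

open import Data.Bool using (Bool; true; false; T; _∨_; if_then_else_)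
open import Data.Bool.Properties using (∨-identityʳ; ∧-zeroʳ; T-≡)
open import Data.Empty using (⊥-elim)
open import Data.List using (List; []; _∷_; _++_; map; upTo; [_])
open import Data.List.Properties using (applyUpTo-∷ʳ; map-++)
open import Data.Nat using (zero; suc; _+_; _*_; _∸_; _<ᵇ_; z≤n; s≤s; NonZero; _/_; _%_)
open import Data.Nat.DivMod
open import Data.Nat.Properties
open import Data.Nat.Tactic.RingSolver using (solve)
open import Data.Product using (∃-syntax; _,_; proj₁; proj₂)
open import Function.Bundles using (Equivalence)
open import Relation.Binary.PropositionalEquality
  using (_≡_; refl; sym; trans; cong; cong₂; subst; module ≡-Reasoning)

-- Write c = b − a. Leaf j < c hangs off spine vertex ⌊ja/c⌋, so the first k
-- spine vertices carry ⌈kc/a⌉ of these leaves; the last leaf hangs off u_a and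
-- acts as an edge from u_a to a non-spine vertex, and the t − 1 extra leaves
-- hang off roots, so they never meet S.  A maximal run [i, i+l) of spine
-- vertices in S meets its l right-hand edges, ⌈(i+l)c/a⌉ − ⌈ic/a⌉ leaves, and,
-- when i > 0, the edge to u_{i-1}: at least l + lc/a = lb/a edges in all.
-- Summing over runs gives a·e(S) ≥ b·|S|, with equality for the whole spine.

𝟙 : Bool → ℕ
𝟙 x = if x then 1 else 0

<ᵇ-true : ∀ {m n} → m < n → (m <ᵇ n) ≡ true
<ᵇ-true m<n = Equivalence.to T-≡ (<⇒<ᵇ m<n)

<ᵇ-false : ∀ {m n} → n ≤ m → (m <ᵇ n) ≡ false
<ᵇ-false {m} {n} n≤m with m <ᵇ n in eq
... | false = refl
... | true  = ⊥-elim (≤⇒≯ n≤m (<ᵇ⇒< m n (subst T (sym eq) _)))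

x+y≤z+w⇒w≤y⇒x≤z : ∀ {x y z w} → x + y ≤ z + w → w ≤ y → x ≤ z
x+y≤z+w⇒w≤y⇒x≤z {x} {y} {z} le w≤y = +-cancelʳ-≤ y x z (≤-trans le (+-monoʳ-≤ z w≤y))

countBelow-cong : ∀ {S S′} n → (∀ i → i < n → S i ≡ S′ i) → countBelow S n ≡ countBelow S′ n
countBelow-cong zero    _  = refl
countBelow-cong (suc n) eq =
  cong₂ (λ x y → 𝟙 x + y) (eq n ≤-refl) (countBelow-cong n (λ i i<n → eq i (m≤n⇒m≤1+n i<n)))

countBelow-all : ∀ S n → (∀ i → i < n → S i ≡ true) → countBelow S n ≡ n
countBelow-all S zero    _   = refl
countBelow-all S (suc n) all =
  cong₂ (λ x y → 𝟙 x + y) (all n ≤-refl) (countBelow-all S n (λ i i<n → all i (m≤n⇒m≤1+n i<n)))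

countBelow-constant-on : ∀ S x n m → (∀ i → n ≤ i → i < m + n → S i ≡ x) →
  countBelow S (m + n) ≡ m * 𝟙 x + countBelow S n
countBelow-constant-on S x n zero    _     = refl
countBelow-constant-on S x n (suc m) const = begin
  𝟙 (S (m + n)) + countBelow S (m + n)      ≡⟨ cong₂ (λ y z → 𝟙 y + z) (const (m + n) (m≤n+m n m) ≤-refl) IH ⟩
  𝟙 x + (m * 𝟙 x + countBelow S n)          ≡⟨ +-assoc (𝟙 x) _ _ ⟨
  suc m * 𝟙 x + countBelow S n              ∎
  where
  open ≡-Reasoning
  IH : countBelow S (m + n) ≡ m * 𝟙 x + countBelow S n
  IH = countBelow-constant-on S x n m (λ i n≤i i<m+n → const i n≤i (m≤n⇒m≤1+n i<m+n))

meets : VSet → ℕ × ℕ → Bool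
meets S (u , v) = S u ∨ S v

countEdges-++ : ∀ S xs ys → countEdges S (xs ++ ys) ≡ countEdges S xs + countEdges S ys
countEdges-++ S []             ys = refl
countEdges-++ S ((u , v) ∷ xs) ys =
  trans (cong (𝟙 (S u ∨ S v) +_) (countEdges-++ S xs ys)) (sym (+-assoc (𝟙 (S u ∨ S v)) _ _))

countEdges-map-upTo : ∀ S (f : ℕ → ℕ × ℕ) n →
  countEdges S (map f (upTo n)) ≡ countBelow (λ i → meets S (f i)) n
countEdges-map-upTo S f zero    = refl
countEdges-map-upTo S f (suc n) = begin
  countEdges S (map f (upTo (suc n)))                      ≡⟨ cong (λ is → countEdges S (map f is)) (applyUpTo-∷ʳ (λ i → i) n) ⟨
  countEdges S (map f (upTo n ++ [ n ]))                   ≡⟨ cong (countEdges S) (map-++ f (upTo n) [ n ]) ⟩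
  countEdges S (map f (upTo n) ++ [ f n ])                 ≡⟨ countEdges-++ S (map f (upTo n)) [ f n ] ⟩
  countEdges S (map f (upTo n)) + countEdges S [ f n ]     ≡⟨ cong₂ _+_ (countEdges-map-upTo S f n) (singleton (f n)) ⟩
  countBelow (λ i → meets S (f i)) n + 𝟙 (meets S (f n))  ≡⟨ +-comm _ (𝟙 (meets S (f n))) ⟩
  countBelow (λ i → meets S (f i)) (suc n)                 ∎
  where
  open ≡-Reasoning
  singleton : ∀ e → countEdges S [ e ] ≡ 𝟙 (meets S e)
  singleton (u , v) = +-identityʳ _

m/n≡k : ∀ {m n k} .{{_ : NonZero n}} → k * n ≤ m → m < suc k * n → m / n ≡ k
m/n≡k {m} {n} {k} lower upper =
  ≤-antisym (≤-pred (m<n*o⇒m/o<n upper)) (subst (_≤ m / n) (m*n/n≡m k n) (/-monoˡ-≤ n lower))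

⌈_/_⌉ : ℕ → (n : ℕ) .{{_ : NonZero n}} → ℕ
⌈ m / n ⌉ = (m + (n ∸ 1)) / n

n*⌈m/n⌉≤m+[n∸1] : ∀ m n .{{_ : NonZero n}} → n * ⌈ m / n ⌉ ≤ m + (n ∸ 1)
n*⌈m/n⌉≤m+[n∸1] m n = ≤-trans (≤-reflexive (*-comm n _)) (m/n*n≤m (m + (n ∸ 1)) n)

m≤n*⌈m/n⌉ : ∀ m n .{{_ : NonZero n}} → m ≤ n * ⌈ m / n ⌉
m≤n*⌈m/n⌉ m n@(suc n-1) = +-cancelʳ-≤ n-1 m (n * q) (begin
  m + n-1      ≡⟨ m≡m%n+[m/n]*n (m + n-1) n ⟩
  r + q * n    ≡⟨ +-comm r (q * n) ⟩
  q * n + r    ≤⟨ +-mono-≤ (≤-reflexive (*-comm q n)) (≤-pred (m%n<n (m + n-1) n)) ⟩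
  n * q + n-1  ∎)
  where
  open ≤-Reasoning
  q : ℕ
  q = ⌈ m / n ⌉
  r : ℕ
  r = (m + n-1) % n

⌈/⌉-monoˡ-≤ : ∀ {m o} n .{{_ : NonZero n}} → m ≤ o → ⌈ m / n ⌉ ≤ ⌈ o / n ⌉
⌈/⌉-monoˡ-≤ n m≤o = /-monoˡ-≤ n (+-monoˡ-≤ (n ∸ 1) m≤o)

⌈n*m/n⌉≡m : ∀ m n .{{_ : NonZero n}} → ⌈ n * m / n ⌉ ≡ m
⌈n*m/n⌉≡m m n@(suc n-1) =
  ≤-antisym (≤-pred (*-cancelˡ-< n _ _ upper)) (*-cancelˡ-≤ n (m≤n*⌈m/n⌉ (n * m) n))
  where
  upper : n * ⌈ n * m / n ⌉ < n * suc m
  upper = begin-strict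
    n * ⌈ n * m / n ⌉  ≤⟨ n*⌈m/n⌉≤m+[n∸1] (n * m) n ⟩
    n * m + n-1        <⟨ +-monoʳ-< (n * m) ≤-refl ⟩
    n * m + n          ≡⟨ +-comm (n * m) n ⟩
    n + n * m          ≡⟨ *-suc n m ⟨
    n * suc m          ∎
    where open ≤-Reasoning

-- The prefix surplus a·e − b·|S| (with b = a + c) is non-negative, and when the
-- next spine vertex lies in S it also covers the rounding error a⌈kc/a⌉ − kc.
Surplus : (a c C E k J : ℕ) → Bool → Set
Surplus a c C E k J s = (s ≡ true → (a + c) * C + a * J ≤ a * E + k * c) × ((a + c) * C ≤ a * E)

-- Along a run both sides of the first inequality grow by the same amount; a run
-- starting at the next vertex is paid for by the edge joining it to the current
-- one, worth a, which exceeds the new rounding error.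
Surplus-step : ∀ {a′ c C P L L′ k J J′} m (s s′ : Bool) →
  J′ ≡ m + J → L′ ≡ m * 𝟙 s + L →
  suc k * c ≤ suc a′ * J′ → suc a′ * J′ ≤ suc k * c + a′ →
  Surplus (suc a′) c C (P + L) k J s →
  Surplus (suc a′) c (𝟙 s + C) ((𝟙 (s ∨ s′) + P) + L′) (suc k) J′ s′
Surplus-step {a′} {c} {C} {P} {L} {k = k} {J} m true s′ refl refl lower _ (inRun , _) =
  (λ _ → inRun′) , x+y≤z+w⇒w≤y⇒x≤z inRun′ lower
  where
  open ≤-Reasoning
  inRun′ : (suc a′ + c) * (1 + C) + suc a′ * (m + J) ≤ suc a′ * ((1 + P) + (m * 1 + L)) + suc k * c
  inRun′ = begin
    (suc a′ + c) * (1 + C) + suc a′ * (m + J)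
      ≡⟨ solve (a′ ∷ c ∷ C ∷ m ∷ J ∷ []) ⟩
    ((suc a′ + c) * C + suc a′ * J) + (suc a′ + c + suc a′ * m)
      ≤⟨ +-monoˡ-≤ _ (inRun refl) ⟩
    (suc a′ * (P + L) + k * c) + (suc a′ + c + suc a′ * m)
      ≡⟨ solve (a′ ∷ c ∷ P ∷ L ∷ k ∷ m ∷ []) ⟩
    suc a′ * ((1 + P) + (m * 1 + L)) + suc k * c
      ∎
Surplus-step {a′} {c} {C} {P} {L} {k = k} {J} m false s′ refl refl _ upper (_ , nonneg) =
  startRun s′ , nonneg′
  where
  open ≤-Reasoning
  nonneg′ : (suc a′ + c) * C ≤ suc a′ * ((𝟙 s′ + P) + (m * 0 + L))
  nonneg′ = ≤-trans nonneg (*-monoʳ-≤ (suc a′) (+-mono-≤ (m≤n+m P (𝟙 s′)) (m≤n+m L (m * 0))))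
  startRun : ∀ s′ → s′ ≡ true →
    (suc a′ + c) * C + suc a′ * (m + J) ≤ suc a′ * ((𝟙 s′ + P) + (m * 0 + L)) + suc k * c
  startRun true refl = begin
    (suc a′ + c) * C + suc a′ * (m + J)        ≤⟨ +-mono-≤ nonneg upper ⟩
    suc a′ * (P + L) + (suc k * c + a′)        <⟨ n<1+n _ ⟩
    suc (suc a′ * (P + L) + (suc k * c + a′))  ≡⟨ solve (a′ ∷ c ∷ P ∷ L ∷ k ∷ m ∷ []) ⟩
    suc a′ * ((1 + P) + (m * 0 + L)) + suc k * c ∎

module Spine (a′ c′ : ℕ) where
  a : ℕ
  a = suc a′

  c : ℕ
  c = suc c′

  -- the number of leaves j < c with ⌊ja/c⌋ < k, i.e. hanging off the first k spine vertices
  J : ℕ → ℕ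
  J k = ⌈ k * c / a ⌉

  J-zero : J 0 ≡ 0
  J-zero = m<n⇒m/n≡0 {a′} {a} ≤-refl

  J-mono : ∀ k → J k ≤ J (suc k)
  J-mono k = ⌈/⌉-monoˡ-≤ a (m≤n+m (k * c) c)

  J-a : J a ≡ c
  J-a = ⌈n*m/n⌉≡m c a

  leaf-position : ∀ {j k} → J k ≤ j → j < J (suc k) → j * a / c ≡ k
  leaf-position {j} {k} J≤j j<J = m/n≡k lower (+-cancelˡ-≤ a′ _ _ upper)
    where
    open ≤-Reasoning
    lower : k * c ≤ j * a
    lower = begin
      k * c    ≤⟨ m≤n*⌈m/n⌉ (k * c) a ⟩
      a * J k  ≤⟨ *-monoʳ-≤ a J≤j ⟩
      a * j    ≡⟨ *-comm a j ⟩
      j * a    ∎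
    upper : a′ + suc (j * a) ≤ a′ + suc k * c
    upper = begin
      a′ + suc (j * a)    ≡⟨ +-suc a′ (j * a) ⟩
      a + j * a           ≡⟨ cong (a +_) (*-comm j a) ⟩
      a + a * j           ≡⟨ *-suc a j ⟨
      a * suc j           ≤⟨ *-monoʳ-≤ a j<J ⟩
      a * J (suc k)       ≤⟨ n*⌈m/n⌉≤m+[n∸1] (suc k * c) a ⟩
      suc k * c + a′      ≡⟨ +-comm (suc k * c) a′ ⟩
      a′ + suc k * c      ∎

  module _ (S : VSet) where
    pathCount : ℕ → ℕ
    pathCount k = countBelow (λ i → S i ∨ S (suc i)) k

    leafCount : ℕ → ℕ
    leafCount k = countBelow (λ j → S (j * a / c)) (J k)

    leafCount-suc : ∀ k → leafCount (suc k) ≡ (J (suc k) ∸ J k) * 𝟙 (S k) + leafCount k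
    leafCount-suc k = begin
      countBelow leafInS (J (suc k))                ≡⟨ cong (countBelow leafInS) J-split ⟨
      countBelow leafInS ((J (suc k) ∸ J k) + J k)  ≡⟨ countBelow-constant-on leafInS (S k) (J k) _ onVertexK ⟩
      (J (suc k) ∸ J k) * 𝟙 (S k) + leafCount k     ∎
      where
      open ≡-Reasoning
      leafInS : VSet
      leafInS j = S (j * a / c)
      J-split : (J (suc k) ∸ J k) + J k ≡ J (suc k)
      J-split = m∸n+n≡m (J-mono k)
      onVertexK : ∀ j → J k ≤ j → j < (J (suc k) ∸ J k) + J k → leafInS j ≡ S k
      onVertexK j J≤j j<J = cong S (leaf-position J≤j (subst (j <_) J-split j<J))

    surplus : ∀ k → Surplus a c (countBelow S k) (pathCount k + leafCount k) k (J k) (S k)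
    surplus zero rewrite J-zero | *-zeroʳ (a + c) | *-zeroʳ a = (λ _ → z≤n) , z≤n
    surplus (suc k) =
      Surplus-step {a′} {c} {k = k} (J (suc k) ∸ J k) (S k) (S (suc k))
        (sym (m∸n+n≡m (J-mono k))) (leafCount-suc k)
        (m≤n*⌈m/n⌉ (suc k * c) a) (n*⌈m/n⌉≤m+[n∸1] (suc k * c) a) (surplus k)

    spine-bound : (a + c) * countBelow S a ≤ a * (pathCount a + countBelow (λ j → S (j * a / c)) c)
    spine-bound = subst (λ n → (a + c) * countBelow S a ≤ a * (pathCount a + countBelow (λ j → S (j * a / c)) n))
      J-a (proj₂ (surplus a))

module _ {a : ℕ} (S : VSet) (outside : ∀ v → a ≤ v → S v ≡ false) where
  countEdges-newLeaves : ∀ r next k → a ≤ r → a ≤ next → countEdges S (newLeaves r next k) ≡ 0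
  countEdges-newLeaves r next zero    _   _      = refl
  countEdges-newLeaves r next (suc k) a≤r a≤next
    rewrite outside r a≤r | outside next a≤next =
    countEdges-newLeaves r (suc next) k a≤r (m≤n⇒m≤1+n a≤next)

  countEdges-extraLeaves : ∀ b t js next → a ≤ next → countEdges S (proj₁ (extraLeaves a b t js next)) ≡ 0
  countEdges-extraLeaves b t []       next _ = refl
  countEdges-extraLeaves b t (j ∷ js) next a≤next with isOdd (seqBC a b j)
  ... | true  = trans (countEdges-++ S (newLeaves (a + j) next (t ∸ 1)) _)
                      (cong₂ _+_ (countEdges-newLeaves (a + j) next (t ∸ 1) (m≤m+n a j) a≤next)
                                 (countEdges-extraLeaves b t js (next + (t ∸ 1)) (≤-trans a≤next (m≤m+n next _))))
  ... | false = countEdges-extraLeaves b t js next a≤next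

next≤extraLeaves : ∀ a b t js next → next ≤ proj₂ (extraLeaves a b t js next)
next≤extraLeaves a b t []       next = ≤-refl
next≤extraLeaves a b t (j ∷ js) next with isOdd (seqBC a b j)
... | true  = ≤-trans (m≤m+n next _) (next≤extraLeaves a b t js (next + (t ∸ 1)))
... | false = next≤extraLeaves a b t js next

module BukhConlon (t a′ c′ : ℕ) where
  open Spine a′ c′

  b : ℕ
  b = a + c

  G : RootedGraph
  G = TSt t a b

  b∸a≡c : b ∸ a ≡ c
  b∸a≡c = m+n∸m≡n a c

  seqBC-leaf : ∀ {j} → j < c → seqBC a b j ≡ suc (j * a / c)
  seqBC-leaf j<c rewrite b∸a≡c | <ᵇ-true j<c = refl

  seqBC-last : seqBC a b c ≡ a
  seqBC-last rewrite b∸a≡c | <ᵇ-false {c} {c} ≤-refl = refl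

  a≤nV : a ≤ nV G
  a≤nV = ≤-trans (m≤m+n a _) (next≤extraLeaves a b t (upTo (suc (b ∸ a))) (a + suc (b ∸ a)))

  module _ (S : VSet) (outside : ∀ v → a ≤ v → S v ≡ false) where
    card-spine : card G S ≡ countBelow S a
    card-spine = begin
      countBelow S (nV G)             ≡⟨ cong (countBelow S) (m∸n+n≡m a≤nV) ⟨
      countBelow S (nV G ∸ a + a)     ≡⟨ countBelow-constant-on S false a (nV G ∸ a) (λ v a≤v _ → outside v a≤v) ⟩
      (nV G ∸ a) * 0 + countBelow S a ≡⟨ cong (_+ countBelow S a) (*-zeroʳ (nV G ∸ a)) ⟩
      countBelow S a                  ∎
      where open ≡-Reasoning

    -- The last root edge u_a r_c is counted in pathCount S a as the edge {a − 1, a}.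
    rootEdges-count : countEdges S (rootEdges a b) ≡ 𝟙 (S a′ ∨ S a) + countBelow (λ j → S (j * a / c)) c
    rootEdges-count = begin
      countEdges S (rootEdges a b)
        ≡⟨ countEdges-map-upTo S rootEdge (suc (b ∸ a)) ⟩
      countBelow (λ j → meets S (rootEdge j)) (suc (b ∸ a))
        ≡⟨ cong (λ n → countBelow (λ j → meets S (rootEdge j)) (suc n)) b∸a≡c ⟩
      𝟙 (meets S (rootEdge c)) + countBelow (λ j → meets S (rootEdge j)) c
        ≡⟨ cong₂ (λ x y → 𝟙 x + y) lastRoot (countBelow-cong c leafRoot) ⟩
      𝟙 (S a′ ∨ S a) + countBelow (λ j → S (j * a / c)) c
        ∎
      where
      open ≡-Reasoning
      rootEdge : ℕ → ℕ × ℕ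
      rootEdge j = (seqBC a b j ∸ 1 , a + j)
      lastRoot : meets S (rootEdge c) ≡ S a′ ∨ S a
      lastRoot rewrite seqBC-last | outside (a + c) (m≤m+n a c) | outside a ≤-refl = refl
      leafRoot : ∀ j → j < c → meets S (rootEdge j) ≡ S (j * a / c)
      leafRoot j j<c rewrite seqBC-leaf j<c | outside (a + j) (m≤m+n a j) = ∨-identityʳ _

    eS-spine : eS G S ≡ pathCount S a + countBelow (λ j → S (j * a / c)) c
    eS-spine = begin
      countEdges S (spineEdges a ++ rootEdges a b ++ extra)
        ≡⟨ countEdges-++ S (spineEdges a) _ ⟩
      countEdges S (spineEdges a) + countEdges S (rootEdges a b ++ extra)
        ≡⟨ cong (countEdges S (spineEdges a) +_) (countEdges-++ S (rootEdges a b) extra) ⟩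
      countEdges S (spineEdges a) + (countEdges S (rootEdges a b) + countEdges S extra)
        ≡⟨ cong₂ (λ x y → x + (y + countEdges S extra))
                 (countEdges-map-upTo S (λ i → (i , suc i)) a′) rootEdges-count ⟩
      pathCount S a′ + ((e + L) + countEdges S extra)
        ≡⟨ cong (λ z → pathCount S a′ + ((e + L) + z))
                (countEdges-extraLeaves S outside b t (upTo (suc (b ∸ a))) _ (m≤m+n a _)) ⟩
      pathCount S a′ + ((e + L) + 0)
        ≡⟨ cong (pathCount S a′ +_) (+-identityʳ (e + L)) ⟩
      pathCount S a′ + (e + L)
        ≡⟨ +-assoc (pathCount S a′) e L ⟨
      (pathCount S a′ + e) + L
        ≡⟨ cong (_+ L) (+-comm (pathCount S a′) e) ⟩
      pathCount S a + L
        ∎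
      where
      open ≡-Reasoning
      extra : List (ℕ × ℕ)
      extra = proj₁ (extraT a b t)
      e : ℕ
      e = 𝟙 (S a′ ∨ S a)
      L : ℕ
      L = countBelow (λ j → S (j * a / c)) c

  N : VSet
  N = nonRoots G

  N-spine : ∀ {v} → v < a → N v ≡ true
  N-spine {v} v<a rewrite <ᵇ-true (<-≤-trans v<a a≤nV) | <ᵇ-false {a′} {v} (≤-pred v<a) = refl

  N-outside : ∀ v → a ≤ v → N v ≡ false
  N-outside v a≤v rewrite Equivalence.to T-≡ (≤⇒≤ᵇ a≤v) = ∧-zeroʳ _

  subset-outside : ∀ {S} → IsNonRootSubset G S → ∀ v → a ≤ v → S v ≡ false
  subset-outside {S} S⊆N v a≤v with S v in Sv
  ... | false = refl
  ... | true  with () ← trans (sym (S⊆N v Sv)) (N-outside v a≤v)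

  card-N : card G N ≡ a
  card-N = trans (card-spine N N-outside) (countBelow-all N a (λ _ → N-spine))

  eS-N : eS G N ≡ b
  eS-N = begin
    eS G N                                                   ≡⟨ eS-spine N N-outside ⟩
    pathCount N a + countBelow (λ j → N (j * a / c)) c       ≡⟨ cong₂ _+_ (countBelow-all _ a pathInN) (countBelow-all _ c leafInN) ⟩
    a + c                                                    ∎
    where
    open ≡-Reasoning
    pathInN : ∀ i → i < a → (N i ∨ N (suc i)) ≡ true
    pathInN i i<a rewrite N-spine i<a = refl
    leafInN : ∀ j → j < c → N (j * a / c) ≡ true
    leafInN j j<c = N-spine (m<n*o⇒m/o<n (subst (j * a <_) (*-comm c a) (*-monoˡ-< a j<c)))

  -- The empty set satisfies the inequality too.
  balanced : Balanced G
  balanced S S⊆N _ = begin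
    eS G N * card G S                   ≡⟨ cong₂ _*_ eS-N (card-spine S outside) ⟩
    (a + c) * countBelow S a            ≤⟨ spine-bound S ⟩
    a * (pathCount S a + L)             ≡⟨ *-comm a _ ⟩
    (pathCount S a + L) * a             ≡⟨ cong₂ _*_ (eS-spine S outside) card-N ⟨
    eS G S * card G N                   ∎
    where
    open ≤-Reasoning
    outside : ∀ v → a ≤ v → S v ≡ false
    outside = subset-outside S⊆N
    L : ℕ
    L = countBelow (λ j → S (j * a / c)) c

  density : HasRootedDensity G b a
  density = subst (0 <_) (sym card-N) (s≤s z≤n) , trans (cong (_* a) eS-N) (cong (b *_) (sym card-N))

<⇒∃[k]m+1+k≡n : ∀ {m n} → m < n → ∃[ k ] m + suc k ≡ n
<⇒∃[k]m+1+k≡n {zero}  {suc n} _         = n , refl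
<⇒∃[k]m+1+k≡n {suc m} {suc n} (s≤s m<n) with <⇒∃[k]m+1+k≡n m<n
... | k , eq = k , cong suc eq

lemma2p3 : (t a b : ℕ) → 1 ≤ t → 1 ≤ a → a < b →
    Balanced (TSt t a b) × HasRootedDensity (TSt t a b) b a
lemma2p3 t (suc a′) b _ _ a<b with <⇒∃[k]m+1+k≡n a<b
... | c′ , refl = BukhConlon.balanced t a′ c′ , BukhConlon.density t a′ c′
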